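{- $\ell(3) = 120$. That is, there is a covering system consisting of one congruence for each divisor $d$ of $120$ with $d \ge 3$ (the divisor $d$ being its modulus), and for every positive integer $m < 120$ there is no covering system consisting of one congruence for each divisor $d$ of $m$ with $d \ge 3$.
   Context: A covering system (covering) is a finite set of congruences $\{x \equiv r_i \pmod{n_i}\}$ with positive integer moduli such that every integer satisfies at least one of them. For an integer $n\ge 2$, $\ell(n)$ denotes the least positive integer such that there exists a covering whose moduli are exactly the divisors of $\ell(n)$ which are at least $n$, each used once. -}

module Defs where

open import Data.Nat using (ℕ; _≤_)
open import Data.Nat.Divisibility using (_∣_)
open import Data.Integer using (ℤ; +_; _-_)
import Data.Integer.Divisibility as ℤD
open import Data.Product using (Σ; ∃; ∃-syntax; _×_)

-- A system assigning to each natural number d a residue r d; only the values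
-- at divisors d of m with d ≥ n are used.  Since r is a function, each admissible divisor is used
-- exactly once as a modulus.
DivisorCovers : ℕ → ℕ → (ℕ → ℤ) → Set
DivisorCovers n m r =
  (x : ℤ) → ∃[ d ] (d ∣ m × n ≤ d × (+ d) ℤD.∣ (x - r d))

HasDivisorCovering : ℕ → ℕ → Set
HasDivisorCovering n m = Σ (ℕ → ℤ) (λ r → DivisorCovers n m r)

module Submission where

-- Write  x mod d  for the least nonnegative residue of x.  A system r of
-- congruences x ≡ r d (mod d), d ranging over  moduli n m  (the divisors
-- d ≥ n of m), covers ℤ exactly when it covers 0, …, m − 1: every x is
-- congruent to x mod m modulo each such d (covering⇒covered and
-- covered⇒covering, built on the residue lemmas congruent⇒mod≡ and
-- mod≡⇒congruent).  So both halves of the theorem become finite problems.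
--
-- Existence: an explicit table of residues, checked on 0, …, 119 by evaluation.
-- Non-existence: a branch-and-bound search (uncoverable).  Given numbers S
-- still to be covered and moduli Ds, either the union bound shows that no
-- residue choice can work (one congruence mod d covers at most the largest
-- residue class of S mod d), or we branch on the residue c of the first
-- modulus d and recurse on the part of S outside c mod d.  uncoverable-sound
-- turns a successful search into an uncovered number for any residue choice;
-- the search succeeds for S = 0, …, m − 1 and every 0 < m < 120 by evaluation.

open import Defs
open import Data.Nat using (ℕ; _<_)
open import Data.Product using (_×_)
open import Relation.Nullary using (¬_)

import Data.Nat.Properties as ℕP
open import Algebra.Properties.CommutativeSemigroup ℕP.+-commutativeSemigroup using (interchange)
open import Data.Bool using (Bool; true; _∧_; _∨_; T; if_then_else_)
open import Data.Bool.Properties using (T-∧; T-∨; T-≡)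
import Data.Integer as Int
open import Data.Integer using (ℤ; +_; _*_; _-_; _%ℕ_; _/ℕ_; ∣_∣)
open import Data.Integer.Divisibility using () renaming (_∣_ to _∣ᵤ_)
open import Data.Integer.DivMod using (n%ℕd<d; a≡a%ℕn+[a/ℕn]*n)
open import Data.Integer.Divisibility.Signed using (divides; ∣ᵤ⇒∣; ∣⇒∣ᵤ; ∣m∣n⇒∣m+n)
  renaming (_∣_ to _∣ˢ_)
open import Data.Integer.Properties using (∣i-j∣≡∣j-i∣; m-n≡m⊖n; ∣m⊝n∣≤m⊔n; ∣i∣≡0⇒i≡0; i-j≡0⇒i≡j; +-injective)
open import Data.Integer.Tactic.RingSolver using (solve-∀)
open import Data.List using (List; []; _∷_; [_]; _++_; length; filter; map; upTo)
open import Data.List.Membership.Propositional using (_∈_; lose; find)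
open import Data.List.Membership.Propositional.Properties using (∈-filter⁺; ∈-filter⁻; ∈-upTo⁺)
open import Data.List.Properties using (filter-++; length-++; filter-accept)
open import Data.List.Relation.Unary.All as All using (All; []; _∷_; all?)
open import Data.List.Relation.Unary.All.Properties using (¬All⇒Any¬)
open import Data.List.Relation.Unary.Any using (Any; here; there; any?)
open import Data.Nat using (zero; suc; z<s; _+_; _≡ᵇ_; _≤_; _⊔_; _<ᵇ_; _≟_; _≤?_; z≤n; s≤s; NonZero; >-nonZero)
open import Data.Nat.Divisibility using (_∣?_; ∣-trans; ∣⇒≤; n∣m⇒m%n≡0; 0∣⇒≡0)
  renaming (_∣_ to _∣ℕ_)
open import Data.Nat.DivMod using (m<n⇒m%n≡m)
open import Data.Nat.ListAction using (sum)
open import Data.Product using (∃-syntax; _,_; proj₁; proj₂)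
open import Data.Sum using (inj₁; inj₂)
open import Function using (_∘_; Equivalence)
open import Relation.Binary.PropositionalEquality
  using (_≡_; refl; sym; trans; cong; cong₂; subst; module ≡-Reasoning)
open import Relation.Nullary using (yes; no; ¬?; isYes; contradiction)
open import Relation.Nullary.Decidable using (_×-dec_; toWitness)
open import Relation.Unary using (Decidable)

_mod_ : ℤ → ℕ → ℕ
x mod zero = 0
x mod suc k = x %ℕ suc k

-- Congruence modulo d: d divides a − b, with the divisibility relation of
-- DivisorCovers.  A record, so that a and b stay visible to type inference.
record Congruent (d : ℕ) (a b : ℤ) : Set where
  constructor congruent
  field divides-difference : + d ∣ᵤ (a - b)
open Congruent

mod<d : ∀ x d .{{_ : NonZero d}} → x mod d < d
mod<d x (suc k) = n%ℕd<d x (suc k)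

congruent-sym : ∀ {d a b} → Congruent d a b → Congruent d b a
congruent-sym {d} {a} {b} (congruent d∣a-b) =
  congruent (subst (d ∣ℕ_) (∣i-j∣≡∣j-i∣ a b) d∣a-b)

congruent-trans : ∀ {d a b c} → Congruent d a b → Congruent d b c → Congruent d a c
congruent-trans {d} {a} {b} {c} (congruent d∣a-b) (congruent d∣b-c) =
  congruent (∣⇒∣ᵤ (subst (+ d ∣ˢ_) (telescope a b c)
    (∣m∣n⇒∣m+n (∣ᵤ⇒∣ {i = a - b} d∣a-b) (∣ᵤ⇒∣ {i = b - c} d∣b-c))))
  where
  telescope : ∀ a b c → (a - b) Int.+ (b - c) ≡ a - c
  telescope = solve-∀

congruent-divisor : ∀ {d m a b} → d ∣ℕ m → Congruent m a b → Congruent d a b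
congruent-divisor d∣m (congruent m∣a-b) = congruent (∣-trans d∣m m∣a-b)

congruent-mod : ∀ x d .{{_ : NonZero d}} → Congruent d x (+ (x mod d))
congruent-mod x d@(suc _) = congruent (∣⇒∣ᵤ (divides (x /ℕ d) (begin
  x - + (x %ℕ d)                               ≡⟨ cong (_- + (x %ℕ d)) (a≡a%ℕn+[a/ℕn]*n x d) ⟩
  (+ (x %ℕ d) Int.+ x /ℕ d * + d) - + (x %ℕ d) ≡⟨ cancel (+ (x %ℕ d)) (x /ℕ d * + d) ⟩
  x /ℕ d * + d                                 ∎)))
  where
  open ≡-Reasoning
  cancel : ∀ r t → (r Int.+ t) - r ≡ t
  cancel = solve-∀

divisible-below⇒0 : ∀ {k d} .{{_ : NonZero d}} → d ∣ℕ k → k < d → k ≡ 0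
divisible-below⇒0 {k} {d} d∣k k<d = trans (sym (m<n⇒m%n≡m k<d)) (n∣m⇒m%n≡0 k d d∣k)

residue-unique : ∀ {d p q} → p < d → q < d → Congruent d (+ p) (+ q) → p ≡ q
residue-unique {d} {p} {q} p<d q<d (congruent d∣p-q) =
  +-injective (i-j≡0⇒i≡j (+ p) (+ q) (∣i∣≡0⇒i≡0 distance≡0))
  where
  distance<d : ∣ + p - + q ∣ < d
  distance<d = ℕP.≤-<-trans
    (subst (_≤ p ⊔ q) (cong ∣_∣ (sym (m-n≡m⊖n p q))) (∣m⊝n∣≤m⊔n p q))
    (ℕP.⊔-lub p<d q<d)
  distance≡0 : ∣ + p - + q ∣ ≡ 0
  distance≡0 = divisible-below⇒0 {{>-nonZero (ℕP.m<n⇒0<n p<d)}} d∣p-q distance<d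

congruent⇒mod≡ : ∀ {a b} d .{{_ : NonZero d}} → Congruent d a b → a mod d ≡ b mod d
congruent⇒mod≡ {a} {b} d a≡b = residue-unique (mod<d a d) (mod<d b d)
  (congruent-trans (congruent-sym (congruent-mod a d)) (congruent-trans a≡b (congruent-mod b d)))

mod≡⇒congruent : ∀ {a b} d .{{_ : NonZero d}} → a mod d ≡ b mod d → Congruent d a b
mod≡⇒congruent {a} {b} d eq = congruent-trans (congruent-mod a d)
  (subst (λ r → Congruent d (+ r) b) (sym eq) (congruent-sym (congruent-mod b d)))

allBelow : ℕ → (ℕ → Bool) → Bool
allBelow zero f = true
allBelow (suc k) f = f k ∧ allBelow k f

allBelow-sound : ∀ {k f c} → T (allBelow k f) → c < k → T (f c)
allBelow-sound {suc k} ok c<1+k with ℕP.m<1+n⇒m<n∨m≡n c<1+k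
... | inj₁ c<k = allBelow-sound (proj₂ (Equivalence.to T-∧ ok)) c<k
... | inj₂ refl = proj₁ (Equivalence.to T-∧ ok)

-- The form in which checks evaluated by `refl` are used.
-- (k and f are explicit so that the evaluated check is never unfolded again.)
allBelow-true : ∀ k f {c} → allBelow k f ≡ true → c < k → T (f c)
allBelow-true _ _ all-true = allBelow-sound (Equivalence.from T-≡ all-true)

maxBelow : ℕ → (ℕ → ℕ) → ℕ
maxBelow zero f = 0
maxBelow (suc k) f = f k ⊔ maxBelow k f

≤maxBelow : ∀ {k f c} → c < k → f c ≤ maxBelow k f
≤maxBelow {suc k} {f} c<1+k with ℕP.m<1+n⇒m<n∨m≡n c<1+k
... | inj₁ c<k = ℕP.m≤n⇒m≤o⊔n (f k) (≤maxBelow c<k)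
... | inj₂ refl = ℕP.m≤m⊔n (f k) (maxBelow k f)

IsModulus : ℕ → ℕ → ℕ → Set
IsModulus n m d = n ≤ d × d ∣ℕ m

isModulus? : ∀ n m → Decidable (IsModulus n m)
isModulus? n m d = (n ≤? d) ×-dec (d ∣? m)

-- The divisors d ≥ n of m, in increasing order (the order in which the
-- search below branches; increasing order keeps it small).
moduli : ℕ → ℕ → List ℕ
moduli n m = filter (isModulus? n m) (upTo (suc m))

∈-moduli⁻ : ∀ {n m d} → d ∈ moduli n m → IsModulus n m d
∈-moduli⁻ {n} {m} = proj₂ ∘ ∈-filter⁻ (isModulus? n m)

∈-moduli⁺ : ∀ {n m d} → 0 < m → n ≤ d → d ∣ℕ m → d ∈ moduli n m
∈-moduli⁺ {n} {m} m>0 n≤d d∣m =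
  ∈-filter⁺ (isModulus? n m) (∈-upTo⁺ (s≤s (∣⇒≤ {{>-nonZero m>0}} d∣m))) (n≤d , d∣m)

divisor-pos : ∀ {d m} → 0 < m → d ∣ℕ m → 0 < d
divisor-pos {zero} m>0 0∣m = contradiction (0∣⇒≡0 0∣m) (ℕP.>⇒≢ m>0)
divisor-pos {suc _} _ _ = z<s

residues : (ℕ → ℤ) → ℕ → ℕ
residues r d = r d mod d

Covered : (ℕ → ℕ) → List ℕ → ℕ → Set
Covered ρ Ds k = Any (λ d → (+ k) mod d ≡ ρ d) Ds

covered? : ∀ ρ Ds → Decidable (Covered ρ Ds)
covered? ρ Ds k = any? (λ d → (+ k) mod d ≟ ρ d) Ds

covering⇒covered : ∀ {n m r} → 0 < m → DivisorCovers n m r →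
                   ∀ k → Covered (residues r) (moduli n m) k
covering⇒covered m>0 cover k with cover (+ k)
... | d , d∣m , n≤d , d∣k-rd = lose (∈-moduli⁺ m>0 n≤d d∣m)
  (congruent⇒mod≡ d {{>-nonZero (divisor-pos m>0 d∣m)}} (congruent d∣k-rd))

-- Conversely, covering the residues 0, …, m − 1 suffices to cover ℤ, since
-- x and x mod m are congruent modulo every divisor of m.
covered⇒covering : ∀ {n m r} → 0 < m →
                   (∀ k → k < m → Covered (residues r) (moduli n m) k) →
                   DivisorCovers n m r
covered⇒covering {n} {m} {r} m>0 covered x =
  witness (find (covered (x mod m) (mod<d x m)))
  where
  instance
    m≢0 : NonZero m
    m≢0 = >-nonZero m>0
  witness : ∃[ d ] (d ∈ moduli n m × (+ (x mod m)) mod d ≡ residues r d) →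
            ∃[ d ] (d ∣ℕ m × n ≤ d × + d ∣ᵤ (x - r d))
  witness (d , d∈ , k≡rd) with n≤d , d∣m ← ∈-moduli⁻ d∈ =
    d , d∣m , n≤d , divides-difference (mod≡⇒congruent d (trans x≡k k≡rd))
    where
    instance
      d≢0 : NonZero d
      d≢0 = >-nonZero (divisor-pos m>0 d∣m)
    x≡k : x mod d ≡ (+ (x mod m)) mod d
    x≡k = congruent⇒mod≡ d (congruent-divisor d∣m (congruent-mod x m))

module _ {A B : Set} {P : B → A → Set} (P? : ∀ b → Decidable (P b)) where

  size : B → List A → ℕ
  size b S = length (filter (P? b) S)

  totalSize : List B → List A → ℕ
  totalSize Bs S = sum (map (λ b → size b S) Bs)

  size-∷ : ∀ b x S → size b (x ∷ S) ≡ size b [ x ] + size b S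
  size-∷ b x S = trans (cong length (filter-++ (P? b) [ x ] S)) (length-++ (filter (P? b) [ x ]))

  totalSize-∷ : ∀ Bs x S → totalSize Bs (x ∷ S) ≡ totalSize Bs [ x ] + totalSize Bs S
  totalSize-∷ [] x S = refl
  totalSize-∷ (b ∷ Bs) x S = begin
    size b (x ∷ S) + totalSize Bs (x ∷ S)
      ≡⟨ cong₂ _+_ (size-∷ b x S) (totalSize-∷ Bs x S) ⟩
    (size b [ x ] + size b S) + (totalSize Bs [ x ] + totalSize Bs S)
      ≡⟨ interchange (size b [ x ]) (size b S) (totalSize Bs [ x ]) (totalSize Bs S) ⟩
    totalSize (b ∷ Bs) [ x ] + totalSize (b ∷ Bs) S ∎
    where open ≡-Reasoning

  counted : ∀ {Bs x} → Any (λ b → P b x) Bs → 1 ≤ totalSize Bs [ x ]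
  counted {b ∷ Bs} {x} (here px) =
    subst (λ xs → 1 ≤ length xs + totalSize Bs [ x ]) (sym (filter-accept (P? b) px)) (s≤s z≤n)
  counted {b ∷ Bs} (there p) = ℕP.≤-trans (counted p) (ℕP.m≤n+m _ _)

  union-bound : ∀ Bs {S} → All (λ x → Any (λ b → P b x) Bs) S → length S ≤ totalSize Bs S
  union-bound Bs [] = z≤n
  union-bound Bs {x ∷ S} (px ∷ pS) = subst (suc (length S) ≤_) (sym (totalSize-∷ Bs x S))
    (ℕP.+-mono-≤ (counted px) (union-bound Bs pS))

sum-map-mono : ∀ {Ds : List ℕ} {f g : ℕ → ℕ} → All (λ d → f d ≤ g d) Ds →
               sum (map f Ds) ≤ sum (map g Ds)
sum-map-mono [] = z≤n
sum-map-mono (f≤g ∷ fs≤gs) = ℕP.+-mono-≤ f≤g (sum-map-mono fs≤gs)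

inClass? : ∀ d c → Decidable (λ n → (+ n) mod d ≡ c)
inClass? d c n = (+ n) mod d ≟ c

-- The size of the largest residue class of S modulo d: an upper bound on the
-- number of elements of S that a single congruence modulo d can cover.
largestClass : ℕ → List ℕ → ℕ
largestClass d S = maxBelow d (λ c → length (filter (inClass? d c) S))

classBound : List ℕ → List ℕ → ℕ
classBound S Ds = sum (map (λ d → largestClass d S) Ds)

-- "No choice of residues for the moduli Ds covers all of S": either by the
-- counting bound, or for every residue c of the first modulus d the
-- numbers of S outside the class c mod d are uncoverable by the rest.
uncoverable : List ℕ → List ℕ → Bool
uncoverable S [] = classBound S [] <ᵇ length S
uncoverable S (d ∷ Ds) = (classBound S (d ∷ Ds) <ᵇ length S)
  ∨ allBelow d (λ c → uncoverable (filter (¬? ∘ inClass? d c) S) Ds)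

uncovered-by-counting : ∀ {ρ} S Ds → All (λ d → ρ d < d) Ds → classBound S Ds < length S →
                        ∃[ n ] (n ∈ S × ¬ Covered ρ Ds n)
uncovered-by-counting {ρ} S Ds ρ<d small with all? (covered? ρ Ds) S
... | yes all-covered = contradiction
  (ℕP.≤-trans (union-bound (λ d → inClass? d (ρ d)) Ds all-covered)
              (sum-map-mono (All.map ≤maxBelow ρ<d)))
  (ℕP.<⇒≱ small)
... | no ¬all-covered = find (¬All⇒Any¬ (covered? ρ Ds) S ¬all-covered)

uncoverable-sound : ∀ {ρ} S Ds → All (λ d → ρ d < d) Ds → T (uncoverable S Ds) →
                    ∃[ n ] (n ∈ S × ¬ Covered ρ Ds n)
uncoverable-sound S [] ρ<d ok = uncovered-by-counting S [] ρ<d (ℕP.<ᵇ⇒< _ _ ok)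
uncoverable-sound {ρ} S (d ∷ Ds) (ρd<d ∷ ρ<d) ok with Equivalence.to T-∨ ok
... | inj₁ small = uncovered-by-counting S (d ∷ Ds) (ρd<d ∷ ρ<d) (ℕP.<ᵇ⇒< _ _ small)
... | inj₂ branches
  with n , n∈ , ¬covered ← uncoverable-sound (filter (¬? ∘ inClass? d (ρ d)) S) Ds ρ<d
                                             (allBelow-sound branches ρd<d)
  with n∈S , n∉class ← ∈-filter⁻ (¬? ∘ inClass? d (ρ d)) n∈ =
  n , n∈S , λ { (here n∈class) → n∉class n∈class ; (there c) → ¬covered c }

no-covering : ∀ {n m} → 0 < m → T (uncoverable (upTo m) (moduli n m)) → ¬ HasDivisorCovering n m
no-covering {n} {m} m>0 search (r , cover) =
  let k , _ , uncovered = uncoverable-sound (upTo m) (moduli n m) residues<d search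
  in uncovered (covering⇒covered m>0 cover k)
  where
  residues<d : All (λ d → residues r d < d) (moduli n m)
  residues<d = All.tabulate λ {d} d∈ →
    mod<d (r d) d {{>-nonZero (divisor-pos m>0 (proj₂ (∈-moduli⁻ {n} d∈)))}}

-- A covering of ℤ by the divisors d ≥ 3 of 120, as (modulus d, residue) pairs.
table₁₂₀ : List (ℕ × ℕ)
table₁₂₀ = (3 , 0) ∷ (4 , 0) ∷ (5 , 0) ∷ (6 , 1) ∷ (8 , 2) ∷ (10 , 1) ∷ (12 , 5)
         ∷ (15 , 2) ∷ (20 , 3) ∷ (24 , 22) ∷ (30 , 29) ∷ (40 , 6) ∷ (60 , 14) ∷ (120 , 38) ∷ []

-- The residue assigned to d (irrelevant for d outside the table).
residueIn : List (ℕ × ℕ) → ℕ → ℕ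
residueIn [] d = 0
residueIn ((d′ , c) ∷ table) d = if d ≡ᵇ d′ then c else residueIn table d

covering₁₂₀ : ℕ → ℤ
covering₁₂₀ d = + residueIn table₁₂₀ d

covered₁₂₀? : Decidable (Covered (residues covering₁₂₀) (moduli 3 120))
covered₁₂₀? = covered? (residues covering₁₂₀) (moduli 3 120)

covering₁₂₀-covers-residues : allBelow 120 (isYes ∘ covered₁₂₀?) ≡ true
covering₁₂₀-covers-residues = refl

search₃ : ℕ → Bool
search₃ m = uncoverable (upTo (suc m)) (moduli 3 (suc m))

search-succeeds-below-120 : allBelow 119 search₃ ≡ true
search-succeeds-below-120 = refl

theorem3 : HasDivisorCovering 3 120
    × ((m : ℕ) → 0 < m → m < 120 → ¬ HasDivisorCovering 3 m)
theorem3 = has-covering , no-smaller-covering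
  where
  has-covering : HasDivisorCovering 3 120
  has-covering = covering₁₂₀ , covered⇒covering z<s λ k k<120 →
    toWitness {a? = covered₁₂₀? k}
      (allBelow-true 120 (isYes ∘ covered₁₂₀?) covering₁₂₀-covers-residues k<120)

  no-smaller-covering : (m : ℕ) → 0 < m → m < 120 → ¬ HasDivisorCovering 3 m
  no-smaller-covering (suc m) _ m<120 =
    no-covering z<s (allBelow-true 119 search₃ search-succeeds-below-120 (ℕP.≤-pred m<120))
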